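{- Let $h(\mathbf{x},z_s,z_t)=q(\mathbf{x})+\kappa_s(\mathbf{x})z_s+\kappa_t(\mathbf{x})z_t$ with $\mathbf{x}\in\mathbb{B}^4$, $z_s,z_t\in\mathbb{B}$, $q\in\mathcal{F}^2$, and $\kappa_s(\mathbf{x})=g_s-\sum_ig_{s,i}x_i$, $\kappa_t(\mathbf{x})=g_t-\sum_ig_{t,i}x_i$ with all $g_{s,i},g_{t,i}\ge0$ (so $h\in\mathcal{F}^2$ and $h$ has no $z_sz_t$ term). Suppose $z_s$ and $z_t$ induce the same partition, i.e. $\{\mathbf{x}:\kappa_s(\mathbf{x})>0\}=\{\mathbf{x}:\kappa_t(\mathbf{x})>0\}$. Then there is $h'(\mathbf{x},z)=q'(\mathbf{x})+\kappa(\mathbf{x})z\in\mathcal{F}^2$ with a single auxiliary variable $z$, $\kappa(\mathbf{x})=g-\sum_ig_ix_i$, $g_i\ge0$, such that $\{\mathbf{x}:\kappa(\mathbf{x})>0\}$ equals this common set and $\min_zh'(\mathbf{x},z)=\min_{z_s,z_t}h(\mathbf{x},z_s,z_t)$ for all $\mathbf{x}$.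
   Context: $\mathbb{B}=\{0,1\}$. $\mathcal{F}^2$: submodular pseudo-Boolean functions of order $\le2$ (multilinear polynomials of degree $\le2$ with non-positive bilinear coefficients). The partition induced by an auxiliary variable with coefficient $\kappa(\mathbf{x})$ consists of the labelings where $z=0$ is the unique minimizer ($\kappa>0$) and the remaining labelings.
   Formalization: The functions q and q' take rational values, and the coefficients of $\kappa_s$, $\kappa_t$, $\kappa$ and of every polynomial in $\mathcal{F}^2$ are rational. -}

module Defs where

open import Data.Bool using (Bool; true; false)
open import Data.Nat using (ℕ; zero; suc)
open import Data.Fin using (Fin; zero; suc; _<_; _<?_)
open import Data.Product using (Σ; _×_; _,_)
open import Data.Rational using (ℚ; 0ℚ; 1ℚ; _+_; _*_; _-_; _≤_; _⊓_)
open import Relation.Nullary using (yes; no)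
open import Relation.Binary.PropositionalEquality using (_≡_)

𝔹^ : ℕ → Set
𝔹^ n = Fin n → Bool

⟦_⟧ : Bool → ℚ
⟦ false ⟧ = 0ℚ
⟦ true ⟧ = 1ℚ

Σ[_] : (n : ℕ) → (Fin n → ℚ) → ℚ
Σ[ zero ] f = 0ℚ
Σ[ suc n ] f = f zero + Σ[ n ] (λ i → f (suc i))

quadPoly : (n : ℕ) → ℚ → (Fin n → ℚ) → (Fin n → Fin n → ℚ) → 𝔹^ n → ℚ
quadPoly n c a b x =
  c + Σ[ n ] (λ i → a i * ⟦ x i ⟧)
    + Σ[ n ] (λ i → Σ[ n ] (λ j → pairTerm i j))
  where
  pairTerm : Fin n → Fin n → ℚ
  pairTerm i j with i <? j
  ... | yes _ = b i j * ⟦ x i ⟧ * ⟦ x j ⟧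
  ... | no _ = 0ℚ

-- 𝓕²: submodular pseudo-Boolean functions of order ≤ 2, i.e. functions
-- equal to a multilinear polynomial of degree ≤ 2 whose bilinear
-- coefficients (i < j) are non-positive.
IsF2 : (n : ℕ) → (𝔹^ n → ℚ) → Set
IsF2 n f = Σ ℚ λ c → Σ (Fin n → ℚ) λ a → Σ (Fin n → Fin n → ℚ) λ b →
  (∀ i j → i < j → b i j ≤ 0ℚ) × (∀ x → f x ≡ quadPoly n c a b x)

kappa : (n : ℕ) → ℚ → (Fin n → ℚ) → 𝔹^ n → ℚ
kappa n g gi x = g - Σ[ n ] (λ i → gi i * ⟦ x i ⟧)

h2 : (𝔹^ 4 → ℚ) → (𝔹^ 4 → ℚ) → (𝔹^ 4 → ℚ) → 𝔹^ 4 → Bool → Bool → ℚ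
h2 q ks kt x zs zt = q x + ks x * ⟦ zs ⟧ + kt x * ⟦ zt ⟧

h1 : (𝔹^ 4 → ℚ) → (𝔹^ 4 → ℚ) → 𝔹^ 4 → Bool → ℚ
h1 q k x z = q x + k x * ⟦ z ⟧

min1 : (𝔹^ 4 → Bool → ℚ) → 𝔹^ 4 → ℚ
min1 f x = f x false ⊓ f x true

min2 : (𝔹^ 4 → Bool → Bool → ℚ) → 𝔹^ 4 → ℚ
min2 f x = (f x false false ⊓ f x false true) ⊓ (f x true false ⊓ f x true true)

{-# OPTIONS --safe #-}
-- Since κₛ(x) and κₜ(x) always have the same sign, min(0, κₛ) + min(0, κₜ) = min(0, κₛ + κₜ).
-- Minimising q + κₛ zₛ + κₜ zₜ over (zₛ, zₜ) gives q + min(0, κₛ) + min(0, κₜ), so the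
-- single variable z with q' = q and κ = κₛ + κₜ does the job; the coefficients of κ are
-- sums of non-negative ones, and κ > 0 exactly where κₛ > 0.
module Submission where

open import Defs
open import Algebra.Bundles using (CommutativeMonoid)
open import Data.Bool using (false; true)
open import Data.Empty using (⊥-elim)
open import Data.Fin using (Fin; zero; suc)
import Data.Nat as ℕ
open import Data.Product using (Σ; _×_; _,_)
open import Data.Rational using (ℚ; 0ℚ; 1ℚ; _≤_; _<_; _+_; _*_; _-_; -_; _⊓_)
open import Data.Rational.Properties
open import Data.Sum using (_⊎_; inj₁; inj₂)
open import Function.Bundles using (_⇔_; mk⇔; Equivalence)
open import Relation.Nullary using (yes; no)
open import Relation.Binary.PropositionalEquality

open import Algebra.Properties.CommutativeSemigroup
  (CommutativeMonoid.commutativeSemigroup +-0-commutativeMonoid) using (interchange)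

Σ-cong : ∀ n {f g : Fin n → ℚ} → (∀ i → f i ≡ g i) → Σ[ n ] f ≡ Σ[ n ] g
Σ-cong ℕ.zero    f≡g = refl
Σ-cong (ℕ.suc n) f≡g = cong₂ _+_ (f≡g zero) (Σ-cong n (λ i → f≡g (suc i)))

Σ-distrib-+ : ∀ n (f g : Fin n → ℚ) → Σ[ n ] (λ i → f i + g i) ≡ Σ[ n ] f + Σ[ n ] g
Σ-distrib-+ ℕ.zero    f g = refl
Σ-distrib-+ (ℕ.suc n) f g =
  trans (cong (f zero + g zero +_) (Σ-distrib-+ n (λ i → f (suc i)) (λ i → g (suc i))))
        (interchange (f zero) (g zero) (Σ[ n ] (λ i → f (suc i))) (Σ[ n ] (λ i → g (suc i))))

kappa-+ : ∀ n g gi g′ gi′ (x : 𝔹^ n) →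
  kappa n (g + g′) (λ i → gi i + gi′ i) x ≡ kappa n g gi x + kappa n g′ gi′ x
kappa-+ n g gi g′ gi′ x = begin
  (g + g′) - Σ[ n ] (λ i → (gi i + gi′ i) * ⟦ x i ⟧)
    ≡⟨ cong (λ s → (g + g′) - s) (Σ-cong n (λ i → *-distribʳ-+ ⟦ x i ⟧ (gi i) (gi′ i))) ⟩
  (g + g′) - Σ[ n ] (λ i → gi i * ⟦ x i ⟧ + gi′ i * ⟦ x i ⟧)
    ≡⟨ cong (λ s → (g + g′) - s) (Σ-distrib-+ n _ _) ⟩
  (g + g′) - (S + S′)
    ≡⟨ cong ((g + g′) +_) (neg-distrib-+ S S′) ⟩
  (g + g′) + (- S + - S′)
    ≡⟨ interchange g g′ (- S) (- S′) ⟩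
  (g - S) + (g′ - S′) ∎
  where
  open ≡-Reasoning
  S  = Σ[ n ] (λ i → gi i * ⟦ x i ⟧)
  S′ = Σ[ n ] (λ i → gi′ i * ⟦ x i ⟧)

sameSign⇒bothPos⊎bothNonPos : ∀ {a b} → (0ℚ < a ⇔ 0ℚ < b) →
  (0ℚ < a × 0ℚ < b) ⊎ (a ≤ 0ℚ × b ≤ 0ℚ)
sameSign⇒bothPos⊎bothNonPos {a} a~b with 0ℚ <? a
... | yes a>0 = inj₁ (a>0 , Equivalence.to a~b a>0)
... | no  a≯0 = inj₂ (≮⇒≥ a≯0 , ≮⇒≥ (λ b>0 → a≯0 (Equivalence.from a~b b>0)))

sameSign⇒pos-+⇔pos : ∀ {a b} → (0ℚ < a ⇔ 0ℚ < b) → (0ℚ < a + b ⇔ 0ℚ < a)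
sameSign⇒pos-+⇔pos a~b with sameSign⇒bothPos⊎bothNonPos a~b
... | inj₁ (a>0 , b>0) = mk⇔ (λ _ → a>0) (λ _ → +-mono-< a>0 b>0)
... | inj₂ (a≤0 , b≤0) =
  mk⇔ (λ a+b>0 → ⊥-elim (<-irrefl refl (<-≤-trans a+b>0 (+-mono-≤ a≤0 b≤0))))
      (λ a>0 → ⊥-elim (<-irrefl refl (<-≤-trans a>0 a≤0)))

sameSign⇒0⊓-distrib-+ : ∀ {a b} → (0ℚ < a ⇔ 0ℚ < b) →
  0ℚ ⊓ (a + b) ≡ 0ℚ ⊓ a + 0ℚ ⊓ b
sameSign⇒0⊓-distrib-+ a~b with sameSign⇒bothPos⊎bothNonPos a~b
... | inj₁ (a>0 , b>0) rewrite p≤q⇒p⊓q≡p (<⇒≤ a>0) | p≤q⇒p⊓q≡p (<⇒≤ b>0) =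
  p≤q⇒p⊓q≡p (<⇒≤ (+-mono-< a>0 b>0))
... | inj₂ (a≤0 , b≤0) rewrite p≥q⇒p⊓q≡q a≤0 | p≥q⇒p⊓q≡q b≤0 =
  p≥q⇒p⊓q≡q (+-mono-≤ a≤0 b≤0)

min-affine-𝔹 : ∀ Q c → (Q + c * ⟦ false ⟧) ⊓ (Q + c * ⟦ true ⟧) ≡ Q + 0ℚ ⊓ c
min-affine-𝔹 Q c = begin
  (Q + c * 0ℚ) ⊓ (Q + c * 1ℚ)  ≡⟨ cong₂ (λ u v → (Q + u) ⊓ (Q + v)) (*-zeroʳ c) (*-identityʳ c) ⟩
  (Q + 0ℚ) ⊓ (Q + c)           ≡⟨ mono-≤-distrib-⊓ (+-monoʳ-≤ Q) 0ℚ c ⟨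
  Q + 0ℚ ⊓ c                   ∎
  where open ≡-Reasoning

min1-h1 : ∀ q k (x : 𝔹^ 4) → min1 (h1 q k) x ≡ q x + 0ℚ ⊓ k x
min1-h1 q k x = min-affine-𝔹 (q x) (k x)

min2-h2 : ∀ q ks kt (x : 𝔹^ 4) →
  min2 (h2 q ks kt) x ≡ q x + 0ℚ ⊓ ks x + 0ℚ ⊓ kt x
min2-h2 q ks kt x = begin
  min2 (h2 q ks kt) x
    ≡⟨ cong₂ _⊓_ (min-affine-𝔹 (Q + a * ⟦ false ⟧) b) (min-affine-𝔹 (Q + a * ⟦ true ⟧) b) ⟩
  (Q + a * ⟦ false ⟧ + 0ℚ ⊓ b) ⊓ (Q + a * ⟦ true ⟧ + 0ℚ ⊓ b)
    ≡⟨ mono-≤-distrib-⊓ (+-monoˡ-≤ (0ℚ ⊓ b)) (Q + a * ⟦ false ⟧) (Q + a * ⟦ true ⟧) ⟨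
  (Q + a * ⟦ false ⟧) ⊓ (Q + a * ⟦ true ⟧) + 0ℚ ⊓ b
    ≡⟨ cong (_+ 0ℚ ⊓ b) (min-affine-𝔹 Q a) ⟩
  Q + 0ℚ ⊓ a + 0ℚ ⊓ b ∎
  where
  open ≡-Reasoning
  Q = q x
  a = ks x
  b = kt x

lemma11 : (q : 𝔹^ 4 → ℚ) → IsF2 4 q →
    (gs : ℚ) (gsi : Fin 4 → ℚ) (gt : ℚ) (gti : Fin 4 → ℚ) →
    (∀ i → 0ℚ ≤ gsi i) → (∀ i → 0ℚ ≤ gti i) →
    (∀ x → (0ℚ < kappa 4 gs gsi x) ⇔ (0ℚ < kappa 4 gt gti x)) →
    Σ (𝔹^ 4 → ℚ) λ q' → Σ ℚ λ g → Σ (Fin 4 → ℚ) λ gi →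
      IsF2 4 q' × (∀ i → 0ℚ ≤ gi i) ×
      (∀ x → (0ℚ < kappa 4 g gi x) ⇔ (0ℚ < kappa 4 gs gsi x)) ×
      (∀ x → min1 (h1 q' (kappa 4 g gi)) x
             ≡ min2 (h2 q (kappa 4 gs gsi) (kappa 4 gt gti)) x)
lemma11 q q∈F2 gs gsi gt gti gsi≥0 gti≥0 κs~κt =
  q , gs + gt , gi , q∈F2 , (λ i → +-mono-≤ (gsi≥0 i) (gti≥0 i)) , κ>0⇔κs>0 , sameMin
  where
  open ≡-Reasoning
  gi = λ i → gsi i + gti i
  κ  = kappa 4 (gs + gt) gi
  κs = kappa 4 gs gsi
  κt = kappa 4 gt gti

  κ>0⇔κs>0 : ∀ x → (0ℚ < κ x) ⇔ (0ℚ < κs x)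
  κ>0⇔κs>0 x = subst (λ k → (0ℚ < k) ⇔ (0ℚ < κs x)) (sym (kappa-+ 4 gs gsi gt gti x))
                     (sameSign⇒pos-+⇔pos (κs~κt x))

  sameMin : ∀ x → min1 (h1 q κ) x ≡ min2 (h2 q κs κt) x
  sameMin x = begin
    min1 (h1 q κ) x                  ≡⟨ min1-h1 q κ x ⟩
    q x + 0ℚ ⊓ κ x                   ≡⟨ cong (λ k → q x + 0ℚ ⊓ k) (kappa-+ 4 gs gsi gt gti x) ⟩
    q x + 0ℚ ⊓ (κs x + κt x)         ≡⟨ cong (q x +_) (sameSign⇒0⊓-distrib-+ (κs~κt x)) ⟩
    q x + (0ℚ ⊓ κs x + 0ℚ ⊓ κt x)    ≡⟨ +-assoc (q x) _ _ ⟨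
    q x + 0ℚ ⊓ κs x + 0ℚ ⊓ κt x      ≡⟨ min2-h2 q κs κt x ⟨
    min2 (h2 q κs κt) x              ∎
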